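{- Let $s\ge1$ be an integer. For integers $m\ge0$ and $\ell$ define $$\mathcal D_{s}(m,\ell)=\sum_{j_{1},\ldots,j_{s-1}\ge 0}\binom{m}{j_{1}}\binom{m-j_{1}}{j_{2}}\cdots\binom{m-j_{1}-\cdots-j_{s-2}}{j_{s-1}}\binom{m+\ell-u}{m},$$ where $u=(s-1)(m-j_{1})+\sum_{i=2}^{s-1}(i-s)j_{i}$. Then for all integers $n,k\ge 0$, $$\mathcal D_{s}(k,n-k)=\binom{n}{k}_{[s]}.$$
   Context: $\mathcal D_s(m,\ell)$ is the generalized Delannoy number of Ramirez and Sirvent with all parameters $a=a_1=\cdots=a_s=1$, written out explicitly above. For integers $n,k$ with $0\le k\le n$, $\binom{n}{k}_{[s]}$ is the number of lattice paths from $(0,0)$ to $(n,k)$ using steps from $\{(1,0),(1,1),(2,1),\ldots,(s,1)\}$; for $k<0$ or $k>n$ it is $0$. Binomial coefficients: $\binom{a}{b}=\frac{a!}{b!(a-b)!}$ if $a\ge b\ge0$ and $0$ otherwise. -}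

module Defs where

open import Data.Nat using (ℕ; zero; suc; _+_; _*_; _∸_)
open import Data.Nat.Combinatorics using (_C_)
open import Data.Integer as ℤ using (ℤ; +_; -[1+_])
open import Data.Fin using (Fin; toℕ; zero; suc)
open import Data.Fin.Properties using () renaming (_≟_ to _≟F_)
open import Data.List using (List; []; _∷_; concatMap; map; upTo; allFin; filter; length; concat)
open import Data.Vec using (Vec; []; _∷_; toList)
open import Data.Product using (_×_; _,_)
open import Data.Product.Properties using (≡-dec)
open import Data.Nat.Properties using () renaming (_≟_ to _≟ℕ_)
open import Relation.Binary.PropositionalEquality using (_≡_)

binomℤ : ℤ → ℤ → ℕ
binomℤ (+ a) (+ b) = a C b     -- stdlib: a C b = 0 when b > a
binomℤ (+ a) -[1+ b ] = 0
binomℤ -[1+ a ] _ = 0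

allVecs : (b n : ℕ) → List (Vec ℕ n)
allVecs b zero = [] ∷ []
allVecs b (suc n) = concatMap (λ j → map (j ∷_) (allVecs b n)) (upTo (suc b))

-- binom(m, j₁) binom(m-j₁, j₂) ⋯ binom(m-j₁-⋯-j_{s-2}, j_{s-1}),
-- called with r = m and the list j₁,…,j_{s-1}.
binomChain : ℤ → List ℕ → ℕ
binomChain r [] = 1
binomChain r (j ∷ js) = binomℤ r (+ j) * binomChain (r ℤ.- + j) js

weightedTail : ℕ → ℕ → List ℕ → ℤ
weightedTail s i [] = + 0
weightedTail s i (j ∷ js) = ((+ i ℤ.- + s) ℤ.* + j) ℤ.+ weightedTail s (suc i) js

uVal : (s m : ℕ) → List ℕ → ℤ
uVal s m [] = + 0
uVal s m (j₁ ∷ js) = ((+ s ℤ.- + 1) ℤ.* (+ m ℤ.- + j₁)) ℤ.+ weightedTail s 2 js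

sumℕ : List ℕ → ℕ
sumℕ [] = 0
sumℕ (x ∷ xs) = x + sumℕ xs

Dterm : (s m : ℕ) (ℓ : ℤ) → List ℕ → ℕ
Dterm s m ℓ js = binomChain (+ m) js * binomℤ ((+ m ℤ.+ ℓ) ℤ.- uVal s m js) (+ m)

-- 𝒟_s(m, ℓ) = Σ_{j₁,…,j_{s-1} ≥ 0} (…).  All summands with some j_i > m vanish
-- (binom(m - j₁ - ⋯ - j_{i-1}, j_i) = 0 then), so the sum ranges over j_i ∈ {0,…,m}.
𝒟 : (s m : ℕ) → ℤ → ℕ
𝒟 s m ℓ = sumℕ (map (λ v → Dterm s m ℓ (toList v)) (allVecs m (s ∸ 1)))

-- Steps for lattice paths: zero ↦ (1,0), suc i ↦ (toℕ i + 1, 1), i.e. (1,1),…,(s,1).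
Step : ℕ → Set
Step s = Fin (suc s)

dx : ∀ {s} → Step s → ℕ
dx zero = 1
dx (suc i) = suc (toℕ i)

dy : ∀ {s} → Step s → ℕ
dy zero = 0
dy (suc i) = 1

endpoint : ∀ {s} → List (Step s) → ℕ × ℕ
endpoint [] = 0 , 0
endpoint (st ∷ p) with endpoint p
... | x , y = dx st + x , dy st + y

seqsOfLength : (s L : ℕ) → List (List (Step s))
seqsOfLength s zero = [] ∷ []
seqsOfLength s (suc L) = concatMap (λ st → map (st ∷_) (seqsOfLength s L)) (allFin (suc s))

-- Every step has x-increment ≥ 1, so a path to (n,k) has at most n steps.
-- binom[s](n,k) = number of lattice paths (0,0) → (n,k) with steps
-- (1,0),(1,1),(2,1),…,(s,1).
binomS : (s n k : ℕ) → ℕ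
binomS s n k =
  length (filter (λ p → ≡-dec _≟ℕ_ _≟ℕ_ (endpoint p) (n , k))
                 (concat (map (seqsOfLength s) (upTo (suc n)))))

-- Both sides are sums over the words w of length k in the letters 0, …, s - 1 of
-- binom(n - |w|, k), where |w| is the letter sum.  On the Delannoy side, expanding the chain
-- of binomial coefficients multinomially makes j₁, …, j_{s-1} the multiplicities of the letters,
-- and u is then (s - 1) k plus the letter sum of the word in the letters i - s, i.e. |w| after
-- shifting every letter by s - 1.  On the path side, a path with L steps has j horizontal steps and
-- L - j = k steps (d, 1), placed in binom(L, k) ways; the letters d - 1 form a word w and the path
-- ends at x = L + |w|, so summing over L ≤ n leaves binom(n - |w|, k).
module Submission where

open import Defs
open import Data.Nat using (ℕ; _≤_)
open import Data.Integer using (+_; _-_)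
open import Relation.Binary.PropositionalEquality using (_≡_)

open import Algebra.Bundles using (CommutativeMonoid)
open import Algebra.Core using (Op₂)
open import Algebra.Structures using (IsCommutativeMonoid)
open import Data.Fin as Fin using (toℕ)
open import Data.Integer as ℤ using (ℤ)
import Data.Integer.Properties as ℤₚ
import Data.Integer.Tactic.RingSolver as ℤ-Solver
open import Data.List
  using (List; []; _∷_; _++_; map; concatMap; applyUpTo; upTo; allFin; tabulate; filter; length)
open import Data.List.Properties using (map-++; map-∘; map-tabulate; map-upTo; map-applyUpTo)
open import Data.Nat using (zero; suc; _+_; _*_; _∸_; _<_; z≤n; s≤s; _≤?_)
open import Data.Nat.Combinatorics
  using (_C_; k>n⇒nCk≡0; nCk+nC[k+1]≡[n+1]C[k+1]; nCk≡nC[n∸k])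
open import Data.Nat.Properties
open import Algebra.Properties.CommutativeSemigroup +-commutativeSemigroup
  using () renaming (interchange to +-interchange; x∙yz≈y∙xz to +-leftComm)
open import Data.Product using (_×_; _,_; proj₁; proj₂)
open import Data.Product.Properties using (≡-dec)
open import Data.Vec using (Vec; toList) renaming ([] to []ᵥ; _∷_ to _∷ᵥ_)
open import Function using (_∘_)
open import Level using (0ℓ)
open import Relation.Binary.PropositionalEquality
  using (_≢_; refl; sym; trans; cong; cong₂; subst; isEquivalence; module ≡-Reasoning)
open import Relation.Nullary using (¬_; Dec; yes; no; contradiction)

private
  variable
    A B D : Set

sumℕ-++ : (xs ys : List ℕ) → sumℕ (xs ++ ys) ≡ sumℕ xs + sumℕ ys
sumℕ-++ []       ys = refl
sumℕ-++ (x ∷ xs) ys = trans (cong (_+_ x) (sumℕ-++ xs ys)) (sym (+-assoc x _ _))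

sumℕ-map-cong : {f g : A → ℕ} (xs : List A) → (∀ x → f x ≡ g x) →
                sumℕ (map f xs) ≡ sumℕ (map g xs)
sumℕ-map-cong []       f≗g = refl
sumℕ-map-cong (x ∷ xs) f≗g = cong₂ _+_ (f≗g x) (sumℕ-map-cong xs f≗g)

sumℕ-map-∘ : (f : B → ℕ) (g : A → B) (xs : List A) →
             sumℕ (map f (map g xs)) ≡ sumℕ (map (f ∘ g) xs)
sumℕ-map-∘ f g xs = cong sumℕ (sym (map-∘ xs))

sumℕ-map-zero : {f : A → ℕ} (xs : List A) → (∀ x → f x ≡ 0) → sumℕ (map f xs) ≡ 0
sumℕ-map-zero []       f≗0 = refl
sumℕ-map-zero (x ∷ xs) f≗0 = cong₂ _+_ (f≗0 x) (sumℕ-map-zero xs f≗0)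

sumℕ-map-+ : (f g : A → ℕ) (xs : List A) →
             sumℕ (map (λ x → f x + g x) xs) ≡ sumℕ (map f xs) + sumℕ (map g xs)
sumℕ-map-+ f g []       = refl
sumℕ-map-+ f g (x ∷ xs) =
  trans (cong (_+_ (f x + g x)) (sumℕ-map-+ f g xs)) (+-interchange (f x) (g x) _ _)

sumℕ-map-*ˡ : (c : ℕ) (f : A → ℕ) (xs : List A) →
              sumℕ (map (λ x → c * f x) xs) ≡ c * sumℕ (map f xs)
sumℕ-map-*ˡ c f []       = sym (*-zeroʳ c)
sumℕ-map-*ˡ c f (x ∷ xs) =
  trans (cong (_+_ (c * f x)) (sumℕ-map-*ˡ c f xs)) (sym (*-distribˡ-+ c (f x) _))

sumℕ-map-concatMap : (f : B → ℕ) (g : A → List B) (xs : List A) →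
                     sumℕ (map f (concatMap g xs)) ≡ sumℕ (map (λ x → sumℕ (map f (g x))) xs)
sumℕ-map-concatMap f g []       = refl
sumℕ-map-concatMap f g (x ∷ xs) = begin
  sumℕ (map f (g x ++ concatMap g xs))
    ≡⟨ cong sumℕ (map-++ f (g x) _) ⟩
  sumℕ (map f (g x) ++ map f (concatMap g xs))
    ≡⟨ sumℕ-++ (map f (g x)) _ ⟩
  sumℕ (map f (g x)) + sumℕ (map f (concatMap g xs))
    ≡⟨ cong (_+_ _) (sumℕ-map-concatMap f g xs) ⟩
  sumℕ (map (λ x → sumℕ (map f (g x))) (x ∷ xs)) ∎
  where open ≡-Reasoning

sumℕ-map-concatMap-map : (f : D → ℕ) (h : A → B → D) (ys : List B) (xs : List A) →
  sumℕ (map f (concatMap (λ x → map (h x) ys) xs))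
    ≡ sumℕ (map (λ x → sumℕ (map (λ y → f (h x y)) ys)) xs)
sumℕ-map-concatMap-map f h ys xs =
  trans (sumℕ-map-concatMap f (λ x → map (h x) ys) xs)
        (sumℕ-map-cong xs (λ x → sumℕ-map-∘ f (h x) ys))

indicator : {P : Set} → Dec P → ℕ
indicator (yes _) = 1
indicator (no _)  = 0

indicator-yes : {P : Set} (P? : Dec P) → P → indicator P? ≡ 1
indicator-yes (yes _) _ = refl
indicator-yes (no ¬p) p = contradiction p ¬p

indicator-no : {P : Set} (P? : Dec P) → ¬ P → indicator P? ≡ 0
indicator-no (yes p) ¬p = contradiction p ¬p
indicator-no (no _)  _  = refl

length-filter : {P : A → Set} (P? : ∀ x → Dec (P x)) (xs : List A) →
                length (filter P? xs) ≡ sumℕ (map (indicator ∘ P?) xs)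
length-filter P? []       = refl
length-filter P? (x ∷ xs) with P? x
... | yes _ = cong suc (length-filter P? xs)
... | no _  = length-filter P? xs

sumUpTo : ℕ → (ℕ → ℕ) → ℕ
sumUpTo zero    f = 0
sumUpTo (suc N) f = f 0 + sumUpTo N (f ∘ suc)

infix 5 sumUpTo
syntax sumUpTo N (λ j → e) = ∑[ j < N ] e

sumℕ-map-applyUpTo : (f : A → ℕ) (g : ℕ → A) (N : ℕ) →
                     sumℕ (map f (applyUpTo g N)) ≡ sumUpTo N (f ∘ g)
sumℕ-map-applyUpTo f g zero    = refl
sumℕ-map-applyUpTo f g (suc N) = cong (_+_ (f (g 0))) (sumℕ-map-applyUpTo f (g ∘ suc) N)

sumℕ-map-upTo : (f : ℕ → ℕ) (N : ℕ) → sumℕ (map f (upTo N)) ≡ sumUpTo N f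
sumℕ-map-upTo f = sumℕ-map-applyUpTo f (λ j → j)

sumUpTo-cong : ∀ N {f g : ℕ → ℕ} → (∀ j → j < N → f j ≡ g j) → sumUpTo N f ≡ sumUpTo N g
sumUpTo-cong zero    f≗g = refl
sumUpTo-cong (suc N) f≗g =
  cong₂ _+_ (f≗g 0 (s≤s z≤n)) (sumUpTo-cong N (λ j j<N → f≗g (suc j) (s≤s j<N)))

sumUpTo-zero : ∀ N {f : ℕ → ℕ} → (∀ j → j < N → f j ≡ 0) → sumUpTo N f ≡ 0
sumUpTo-zero zero    f≗0 = refl
sumUpTo-zero (suc N) f≗0 =
  cong₂ _+_ (f≗0 0 (s≤s z≤n)) (sumUpTo-zero N (λ j j<N → f≗0 (suc j) (s≤s j<N)))

sumUpTo-+ : ∀ N (f g : ℕ → ℕ) → (∑[ j < N ] (f j + g j)) ≡ sumUpTo N f + sumUpTo N g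
sumUpTo-+ zero    f g = refl
sumUpTo-+ (suc N) f g =
  trans (cong (_+_ (f 0 + g 0)) (sumUpTo-+ N (f ∘ suc) (g ∘ suc))) (+-interchange (f 0) (g 0) _ _)

sumUpTo-truncate : ∀ {N M} (f : ℕ → ℕ) → N ≤ M → (∀ j → N ≤ j → f j ≡ 0) →
                   sumUpTo M f ≡ sumUpTo N f
sumUpTo-truncate {zero}  {M}     f _         f≗0 = sumUpTo-zero M (λ j _ → f≗0 j z≤n)
sumUpTo-truncate {suc N} {suc M} f (s≤s N≤M) f≗0 =
  cong (_+_ (f 0)) (sumUpTo-truncate (f ∘ suc) N≤M (λ j N≤j → f≗0 (suc j) (s≤s N≤j)))

sumUpTo-single : ∀ N (f : ℕ → ℕ) i → i < N → (∀ j → j < N → j ≢ i → f j ≡ 0) →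
                 sumUpTo N f ≡ f i
sumUpTo-single (suc N) f zero    _         f≗0 =
  trans (cong (_+_ (f 0)) (sumUpTo-zero N (λ j j<N → f≗0 (suc j) (s≤s j<N) λ ())))
        (+-identityʳ (f 0))
sumUpTo-single (suc N) f (suc i) (s≤s i<N) f≗0 =
  trans (cong (_+ sumUpTo N (f ∘ suc)) (f≗0 0 (s≤s z≤n) λ ()))
        (sumUpTo-single N (f ∘ suc) i i<N
           (λ j j<N j≢i → f≗0 (suc j) (s≤s j<N) (j≢i ∘ suc-injective)))

sumℕ-map-sumUpTo : ∀ N (F : A → ℕ → ℕ) (xs : List A) →
  sumℕ (map (λ x → sumUpTo N (F x)) xs) ≡ ∑[ j < N ] sumℕ (map (λ x → F x j) xs)
sumℕ-map-sumUpTo N F []       = sym (sumUpTo-zero N (λ _ _ → refl))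
sumℕ-map-sumUpTo N F (x ∷ xs) =
  trans (cong (_+_ (sumUpTo N (F x))) (sumℕ-map-sumUpTo N F xs)) (sym (sumUpTo-+ N (F x) _))

nCk*-cong : ∀ n k {x y : ℕ} → (k ≤ n → x ≡ y) → (n C k) * x ≡ (n C k) * y
nCk*-cong n k {x} {y} x≡y with k ≤? n
... | yes k≤n = cong ((n C k) *_) (x≡y k≤n)
... | no  k≰n = begin
  (n C k) * x ≡⟨ cong (_* x) (k>n⇒nCk≡0 (≰⇒> k≰n)) ⟩
  0           ≡⟨ cong (_* y) (k>n⇒nCk≡0 (≰⇒> k≰n)) ⟨
  (n C k) * y ∎
  where open ≡-Reasoning

sumUpTo-pascal : ∀ r (Y : ℕ → ℕ) →
  (∑[ j < suc r ] (r C j) * Y (suc j)) + (∑[ j < suc r ] (r C j) * Y j)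
    ≡ ∑[ j < suc (suc r) ] (suc r C j) * Y j
sumUpTo-pascal r Y = begin
  Yₛ + (∑[ j < suc r ] (r C j) * Y j)
    ≡⟨ cong (_+_ Yₛ) (sumUpTo-truncate (λ j → (r C j) * Y j) (n≤1+n (suc r)) vanish) ⟨
  Yₛ + (1 * Y 0 + (∑[ j < suc r ] (r C suc j) * Y (suc j)))
    ≡⟨ +-leftComm Yₛ (1 * Y 0) _ ⟩
  1 * Y 0 + (Yₛ + (∑[ j < suc r ] (r C suc j) * Y (suc j)))
    ≡⟨ cong (_+_ (1 * Y 0))
            (sumUpTo-+ (suc r) (λ j → (r C j) * Y (suc j)) (λ j → (r C suc j) * Y (suc j))) ⟨
  1 * Y 0 + (∑[ j < suc r ] ((r C j) * Y (suc j) + (r C suc j) * Y (suc j)))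
    ≡⟨ cong (_+_ (1 * Y 0)) (sumUpTo-cong (suc r) (λ j _ → pascal j)) ⟩
  1 * Y 0 + (∑[ j < suc r ] (suc r C suc j) * Y (suc j)) ∎
  where
  open ≡-Reasoning
  Yₛ = ∑[ j < suc r ] (r C j) * Y (suc j)
  vanish : ∀ j → suc r ≤ j → (r C j) * Y j ≡ 0
  vanish j r<j = cong (_* Y j) (k>n⇒nCk≡0 r<j)
  pascal : ∀ j → (r C j) * Y (suc j) + (r C suc j) * Y (suc j) ≡ (suc r C suc j) * Y (suc j)
  pascal j = trans (sym (*-distribʳ-+ (Y (suc j)) (r C j) _))
                   (cong (_* Y (suc j)) (nCk+nC[k+1]≡[n+1]C[k+1] r j))

module WordSum {M : Set} {_∙_ : Op₂ M} {ε : M}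
               (isCommutativeMonoid : IsCommutativeMonoid _≡_ _∙_ ε) where

  private
    commutativeMonoid : CommutativeMonoid 0ℓ 0ℓ
    commutativeMonoid = record { isCommutativeMonoid = isCommutativeMonoid }

  open CommutativeMonoid commutativeMonoid using (assoc; identityˡ; rawMonoid; commutativeSemigroup)
  open import Algebra.Definitions.RawMonoid rawMonoid public using () renaming (_×_ to _·_)
  open import Algebra.Properties.CommutativeSemigroup commutativeSemigroup
    using (interchange; x∙yz≈y∙xz)

  wordSum : List M → ℕ → (M → ℕ) → ℕ
  wordSum vs zero    g = g ε
  wordSum vs (suc r) g = sumℕ (map (λ d → wordSum vs r (λ t → g (d ∙ t))) vs)

  wordSum-cong : ∀ vs r {g h : M → ℕ} → (∀ t → g t ≡ h t) → wordSum vs r g ≡ wordSum vs r h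
  wordSum-cong vs zero    g≗h = g≗h ε
  wordSum-cong vs (suc r) g≗h = sumℕ-map-cong vs (λ d → wordSum-cong vs r (g≗h ∘ (d ∙_)))

  wordSum-zero : ∀ vs r {g : M → ℕ} → (∀ t → g t ≡ 0) → wordSum vs r g ≡ 0
  wordSum-zero vs zero    g≗0 = g≗0 ε
  wordSum-zero vs (suc r) g≗0 = sumℕ-map-zero vs (λ d → wordSum-zero vs r (g≗0 ∘ (d ∙_)))

  wordSum-+ : ∀ vs r (g h : M → ℕ) →
              wordSum vs r (λ t → g t + h t) ≡ wordSum vs r g + wordSum vs r h
  wordSum-+ vs zero    g h = refl
  wordSum-+ vs (suc r) g h =
    trans (sumℕ-map-cong vs (λ d → wordSum-+ vs r _ _)) (sumℕ-map-+ _ _ vs)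

  wordSum-*ˡ : ∀ vs r c (g : M → ℕ) → wordSum vs r (λ t → c * g t) ≡ c * wordSum vs r g
  wordSum-*ˡ vs zero    c g = refl
  wordSum-*ˡ vs (suc r) c g =
    trans (sumℕ-map-cong vs (λ d → wordSum-*ˡ vs r c _)) (sumℕ-map-*ˡ c _ vs)

  wordSum-sumUpTo : ∀ vs r N (F : ℕ → M → ℕ) →
    wordSum vs r (λ t → ∑[ L < N ] F L t) ≡ ∑[ L < N ] wordSum vs r (F L)
  wordSum-sumUpTo vs r zero    F = wordSum-zero vs r (λ _ → refl)
  wordSum-sumUpTo vs r (suc N) F =
    trans (wordSum-+ vs r (F 0) _) (cong (_+_ (wordSum vs r (F 0))) (wordSum-sumUpTo vs r N (F ∘ suc)))

  wordSum-[ε] : ∀ r (g : M → ℕ) → wordSum (ε ∷ []) r g ≡ g ε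
  wordSum-[ε] zero    g = refl
  wordSum-[ε] (suc r) g = trans (+-identityʳ _) (trans (wordSum-[ε] r _) (cong g (identityˡ ε)))

  wordSum-translate : ∀ c vs r (g : M → ℕ) →
    wordSum vs r (λ t → g ((r · c) ∙ t)) ≡ wordSum (map (c ∙_) vs) r g
  wordSum-translate c vs zero    g = cong g (identityˡ ε)
  wordSum-translate c vs (suc r) g = begin
    sumℕ (map (λ d → wordSum vs r (λ t → g ((c ∙ (r · c)) ∙ (d ∙ t)))) vs)
      ≡⟨ sumℕ-map-cong vs (λ d → wordSum-cong vs r (cong g ∘ interchange c (r · c) d)) ⟩
    sumℕ (map (λ d → wordSum vs r (λ t → g ((c ∙ d) ∙ ((r · c) ∙ t)))) vs)
      ≡⟨ sumℕ-map-cong vs (λ d → wordSum-translate c vs r (g ∘ ((c ∙ d) ∙_))) ⟩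
    sumℕ (map (λ d → wordSum (map (c ∙_) vs) r (g ∘ ((c ∙ d) ∙_))) vs)
      ≡⟨ sumℕ-map-∘ (λ d → wordSum (map (c ∙_) vs) r (g ∘ (d ∙_))) (c ∙_) vs ⟨
    wordSum (map (c ∙_) vs) (suc r) g ∎
    where open ≡-Reasoning

  -- Multinomial expansion in the first letter: j counts its occurrences among the r positions.
  wordSum-∷ : ∀ a vs r (g : M → ℕ) →
    wordSum (a ∷ vs) r g ≡ ∑[ j < suc r ] (r C j) * wordSum vs (r ∸ j) (λ t → g ((j · a) ∙ t))
  wordSum-∷ a vs zero    g =
    trans (cong g (sym (identityˡ ε))) (sym (trans (+-identityʳ _) (*-identityˡ _)))
  wordSum-∷ a vs (suc r) g = begin
    wordSum (a ∷ vs) r (g ∘ (a ∙_)) + sumℕ (map (λ d → wordSum (a ∷ vs) r (g ∘ (d ∙_))) vs)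
      ≡⟨ cong₂ _+_ (wordSum-∷ a vs r _) (sumℕ-map-cong vs (λ d → wordSum-∷ a vs r _)) ⟩
    (∑[ j < suc r ] (r C j) * X a j) + sumℕ (map (λ d → ∑[ j < suc r ] (r C j) * X d j) vs)
      ≡⟨ cong₂ _+_ (sumUpTo-cong (suc r) (λ j _ → cong ((r C j) *_) (headIsA j)))
                   (sumℕ-map-sumUpTo (suc r) (λ d j → (r C j) * X d j) vs) ⟩
    (∑[ j < suc r ] (r C j) * Y (suc j)) + (∑[ j < suc r ] sumℕ (map (λ d → (r C j) * X d j) vs))
      ≡⟨ cong (_+_ (∑[ j < suc r ] (r C j) * Y (suc j))) (sumUpTo-cong (suc r) (λ j _ → headInVs j)) ⟩
    (∑[ j < suc r ] (r C j) * Y (suc j)) + (∑[ j < suc r ] (r C j) * Y j)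
      ≡⟨ sumUpTo-pascal r Y ⟩
    (∑[ j < suc (suc r) ] (suc r C j) * Y j) ∎
    where
    open ≡-Reasoning
    X : M → ℕ → ℕ
    X d j = wordSum vs (r ∸ j) (λ t → g (d ∙ ((j · a) ∙ t)))
    Y : ℕ → ℕ
    Y j = wordSum vs (suc r ∸ j) (λ t → g ((j · a) ∙ t))
    headIsA : ∀ j → X a j ≡ Y (suc j)
    headIsA j = wordSum-cong vs (r ∸ j) (cong g ∘ sym ∘ assoc a (j · a))
    headInVs : ∀ j → sumℕ (map (λ d → (r C j) * X d j) vs) ≡ (r C j) * Y j
    headInVs j = begin
      sumℕ (map (λ d → (r C j) * X d j) vs)
        ≡⟨ sumℕ-map-*ˡ (r C j) _ vs ⟩
      (r C j) * sumℕ (map (λ d → X d j) vs)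
        ≡⟨ cong ((r C j) *_) (sumℕ-map-cong vs (λ d →
             wordSum-cong vs (r ∸ j) (cong g ∘ x∙yz≈y∙xz d (j · a)))) ⟩
      (r C j) * wordSum vs (suc (r ∸ j)) (λ t → g ((j · a) ∙ t))
        ≡⟨ nCk*-cong r j (λ j≤r →
             cong (λ m → wordSum vs m (λ t → g ((j · a) ∙ t))) (sym (+-∸-assoc 1 j≤r))) ⟩
      (r C j) * Y j ∎

wordSum-map-hom : {M N : Set} {_∙_ : Op₂ M} {ε : M} {_◦_ : Op₂ N} {ι : N}
  (M-isCM : IsCommutativeMonoid _≡_ _∙_ ε) (N-isCM : IsCommutativeMonoid _≡_ _◦_ ι)
  (h : N → M) → h ι ≡ ε → (∀ a b → h (a ◦ b) ≡ h a ∙ h b) →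
  ∀ vs r (g : M → ℕ) → WordSum.wordSum N-isCM vs r (g ∘ h) ≡ WordSum.wordSum M-isCM (map h vs) r g
wordSum-map-hom M-isCM N-isCM h h-ι h-◦ vs zero    g = cong g h-ι
wordSum-map-hom {_∙_ = _∙_} {_◦_ = _◦_} M-isCM N-isCM h h-ι h-◦ vs (suc r) g = begin
  sumℕ (map (λ d → N.wordSum vs r (λ t → g (h (d ◦ t)))) vs)
    ≡⟨ sumℕ-map-cong vs (λ d → N.wordSum-cong vs r (cong g ∘ h-◦ d)) ⟩
  sumℕ (map (λ d → N.wordSum vs r (λ t → g (h d ∙ h t))) vs)
    ≡⟨ sumℕ-map-cong vs (λ d → wordSum-map-hom M-isCM N-isCM h h-ι h-◦ vs r (g ∘ (h d ∙_))) ⟩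
  sumℕ (map (λ d → M.wordSum (map h vs) r (g ∘ (h d ∙_))) vs)
    ≡⟨ sumℕ-map-∘ (λ d → M.wordSum (map h vs) r (g ∘ (d ∙_))) h vs ⟨
  M.wordSum (map h vs) (suc r) g ∎
  where
  open ≡-Reasoning
  module M = WordSum M-isCM
  module N = WordSum N-isCM

module ℤW = WordSum ℤₚ.+-0-isCommutativeMonoid

·-ℤ : ∀ j a → j ℤW.· a ≡ a ℤ.* + j
·-ℤ zero    a = sym (ℤₚ.*-zeroʳ a)
·-ℤ (suc j) a = trans (cong (ℤ._+_ a) (·-ℤ j a)) (distrib a (+ j))
  where
  distrib : ∀ a b → a ℤ.+ a ℤ.* b ≡ a ℤ.* (+ 1 ℤ.+ b)
  distrib = ℤ-Solver.solve-∀

+m-+n≡+[m∸n] : ∀ {m n} → n ≤ m → + m - + n ≡ + (m ∸ n)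
+m-+n≡+[m∸n] {m} {n} n≤m = trans (ℤₚ.m-n≡m⊖n m n) (ℤₚ.⊖-≥ n≤m)

-- In the multinomial expansion of binomChain the index at position i of weightedTail s i counts
-- the letter i - s, and the remainder r - j₁ - ⋯ counts the letter 0.
chainLetters : (s i c : ℕ) → List ℤ
chainLetters s i zero    = + 0 ∷ []
chainLetters s i (suc c) = (+ i - + s) ∷ chainLetters s (suc i) c

binomChain-wordSum : ∀ s i c {b r} → r ≤ b → (g : ℤ → ℕ) →
  sumℕ (map (λ v → binomChain (+ r) (toList v) * g (weightedTail s i (toList v))) (allVecs b c))
    ≡ ℤW.wordSum (chainLetters s i c) r g
binomChain-wordSum s i zero {r = r} r≤b g =
  trans (+-identityʳ _) (trans (*-identityˡ _) (sym (ℤW.wordSum-[ε] r g)))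
binomChain-wordSum s i (suc c) {b} {r} r≤b g = begin
  sumℕ (map F (allVecs b (suc c)))
    ≡⟨ sumℕ-map-concatMap-map F _∷ᵥ_ (allVecs b c) (upTo (suc b)) ⟩
  sumℕ (map (λ j → sumℕ (map (λ v → F (j ∷ᵥ v)) (allVecs b c))) (upTo (suc b)))
    ≡⟨ sumℕ-map-upTo _ (suc b) ⟩
  (∑[ j < suc b ] sumℕ (map (λ v → F (j ∷ᵥ v)) (allVecs b c)))
    ≡⟨ sumUpTo-cong (suc b) (λ j _ → firstIndex j) ⟩
  sumUpTo (suc b) T
    ≡⟨ sumUpTo-truncate T (s≤s r≤b) (λ j r<j → cong (_* U j) (k>n⇒nCk≡0 r<j)) ⟩
  sumUpTo (suc r) T
    ≡⟨ ℤW.wordSum-∷ a rest r g ⟨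
  ℤW.wordSum (chainLetters s i (suc c)) r g ∎
  where
  open ≡-Reasoning
  a = + i - + s
  rest = chainLetters s (suc i) c
  F : Vec ℕ (suc c) → ℕ
  F v = binomChain (+ r) (toList v) * g (weightedTail s i (toList v))
  U T : ℕ → ℕ
  U j = ℤW.wordSum rest (r ∸ j) (λ t → g ((j ℤW.· a) ℤ.+ t))
  T j = (r C j) * U j
  G : ℕ → ℤ → ℕ
  G j t = g (a ℤ.* + j ℤ.+ t)
  tailSum : ℤ → ℕ → ℕ
  tailSum x j =
    sumℕ (map (λ v → binomChain x (toList v) * G j (weightedTail s (suc i) (toList v))) (allVecs b c))
  firstIndex : ∀ j → sumℕ (map (λ v → F (j ∷ᵥ v)) (allVecs b c)) ≡ T j
  firstIndex j = begin
    sumℕ (map (λ v → F (j ∷ᵥ v)) (allVecs b c))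
      ≡⟨ sumℕ-map-cong (allVecs b c) (λ v → *-assoc (r C j) _ _) ⟩
    sumℕ (map (λ v → (r C j) * (binomChain (+ r - + j) (toList v) * G j (weightedTail s (suc i) (toList v))))
              (allVecs b c))
      ≡⟨ sumℕ-map-*ˡ (r C j) _ (allVecs b c) ⟩
    (r C j) * tailSum (+ r - + j) j
      ≡⟨ nCk*-cong r j (λ j≤r → cong (λ x → tailSum x j) (+m-+n≡+[m∸n] j≤r)) ⟩
    (r C j) * tailSum (+ (r ∸ j)) j
      ≡⟨ cong ((r C j) *_) (binomChain-wordSum s (suc i) c (≤-trans (m∸n≤m r j) r≤b) (G j)) ⟩
    (r C j) * ℤW.wordSum rest (r ∸ j) (G j)
      ≡⟨ cong ((r C j) *_) (ℤW.wordSum-cong rest (r ∸ j) (λ t → cong (λ x → g (x ℤ.+ t)) (sym (·-ℤ j a))))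
       ⟩
    T j ∎

uVal≡weightedTail : ∀ s′ m (v : Vec ℕ s′) →
  uVal (suc s′) m (toList v) ≡ + s′ ℤ.* + m ℤ.+ weightedTail (suc s′) 1 (toList v)
uVal≡weightedTail zero     m []ᵥ       = refl
uVal≡weightedTail (suc s′) m (j ∷ᵥ v) =
  regroup (+ s′) (+ m) (+ j) (weightedTail (suc (suc s′)) 2 (toList v))
  where
  regroup : ∀ S M J W → (+ 1 ℤ.+ (+ 1 ℤ.+ S) - + 1) ℤ.* (M - J) ℤ.+ W
                      ≡ (+ 1 ℤ.+ S) ℤ.* M ℤ.+ ((+ 1 - (+ 1 ℤ.+ (+ 1 ℤ.+ S))) ℤ.* J ℤ.+ W)
  regroup = ℤ-Solver.solve-∀

applyUpTo-cong : ∀ N {f g : ℕ → A} → (∀ x → f x ≡ g x) → applyUpTo f N ≡ applyUpTo g N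
applyUpTo-cong zero    f≗g = refl
applyUpTo-cong (suc N) f≗g = cong₂ _∷_ (f≗g 0) (applyUpTo-cong N (f≗g ∘ suc))

chainLetters-shift : ∀ s′ i c → i + c ≡ s′ →
  map (ℤ._+_ (+ s′)) (chainLetters (suc s′) (suc i) c) ≡ map (λ x → + x) (applyUpTo (_+_ i) (suc c))
chainLetters-shift s′ i zero    i+0≡s′ = cong (λ x → + x ∷ []) (trans (+-identityʳ s′) (sym i+0≡s′))
chainLetters-shift s′ i (suc c) i+c≡s′ = cong₂ _∷_
  (trans (cancel (+ s′) (+ i)) (cong (λ x → + x) (sym (+-identityʳ i))))
  (trans (chainLetters-shift s′ (suc i) c (trans (sym (+-suc i c)) i+c≡s′))
         (cong (map (λ x → + x)) (applyUpTo-cong (suc c) (λ x → sym (+-suc i x)))))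
  where
  cancel : ∀ S I → S ℤ.+ ((+ 1 ℤ.+ I) - (+ 1 ℤ.+ S)) ≡ I
  cancel = ℤ-Solver.solve-∀

𝒟-wordSum : ∀ s′ n k → 𝒟 (suc s′) k (+ n - + k)
  ≡ ℤW.wordSum (map (λ x → + x) (upTo (suc s′))) k (λ t → binomℤ (+ n - t) (+ k))
𝒟-wordSum s′ n k = begin
  sumℕ (map (λ v → Dterm (suc s′) k (+ n - + k) (toList v)) (allVecs k s′))
    ≡⟨ sumℕ-map-cong (allVecs k s′) (λ v →
         cong (λ z → binomChain (+ k) (toList v) * binomℤ z (+ k)) (top v)) ⟩
  sumℕ (map (λ v → binomChain (+ k) (toList v) * h (+ s′ ℤ.* + k ℤ.+ weightedTail (suc s′) 1 (toList v)))
            (allVecs k s′))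
    ≡⟨ binomChain-wordSum (suc s′) 1 s′ ≤-refl (λ t → h (+ s′ ℤ.* + k ℤ.+ t)) ⟩
  ℤW.wordSum (chainLetters (suc s′) 1 s′) k (λ t → h (+ s′ ℤ.* + k ℤ.+ t))
    ≡⟨ ℤW.wordSum-cong _ k (λ t → cong (λ x → h (x ℤ.+ t)) (sym (·-ℤ k (+ s′)))) ⟩
  ℤW.wordSum (chainLetters (suc s′) 1 s′) k (λ t → h ((k ℤW.· + s′) ℤ.+ t))
    ≡⟨ ℤW.wordSum-translate (+ s′) _ k h ⟩
  ℤW.wordSum (map (ℤ._+_ (+ s′)) (chainLetters (suc s′) 1 s′)) k h
    ≡⟨ cong (λ vs → ℤW.wordSum vs k h) (chainLetters-shift s′ 0 s′ refl) ⟩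
  ℤW.wordSum (map (λ x → + x) (upTo (suc s′))) k h ∎
  where
  open ≡-Reasoning
  h : ℤ → ℕ
  h t = binomℤ (+ n - t) (+ k)
  top : ∀ v → (+ k ℤ.+ (+ n - + k)) - uVal (suc s′) k (toList v)
            ≡ + n - (+ s′ ℤ.* + k ℤ.+ weightedTail (suc s′) 1 (toList v))
  top v = trans (cong (_-_ (+ k ℤ.+ (+ n - + k))) (uVal≡weightedTail s′ k v)) (cancel (+ k) (+ n) _)
    where
    cancel : ∀ K N U → K ℤ.+ (N - K) - U ≡ N - U
    cancel = ℤ-Solver.solve-∀

_⊕_ : ℕ × ℕ → ℕ × ℕ → ℕ × ℕ
(a , b) ⊕ (c , d) = (a + c , b + d)

⊕-isCommutativeMonoid : IsCommutativeMonoid _≡_ _⊕_ (0 , 0)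
⊕-isCommutativeMonoid = record
  { isMonoid = record
    { isSemigroup = record
      { isMagma = record { isEquivalence = isEquivalence ; ∙-cong = cong₂ _⊕_ }
      ; assoc   = λ { (a , b) (c , d) (e , f) → cong₂ _,_ (+-assoc a c e) (+-assoc b d f) }
      }
    ; identity = (λ _ → refl) , λ { (a , b) → cong₂ _,_ (+-identityʳ a) (+-identityʳ b) }
    }
  ; comm = λ { (a , b) (c , d) → cong₂ _,_ (+-comm a c) (+-comm b d) }
  }

module ℕ²W = WordSum ⊕-isCommutativeMonoid
module ℕW = WordSum +-0-isCommutativeMonoid

·-horizontal : ∀ j → j ℕ²W.· (1 , 0) ≡ (j , 0)
·-horizontal zero    = refl
·-horizontal (suc j) = cong ((1 , 0) ⊕_) (·-horizontal j)

·-ℕ : ∀ j → j ℕW.· 1 ≡ j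
·-ℕ zero    = refl
·-ℕ (suc j) = cong suc (·-ℕ j)

wordSum-vertical : ∀ ds m (G : ℕ × ℕ → ℕ) →
  ℕ²W.wordSum (map (_, 1) ds) m G ≡ ℕW.wordSum ds m (λ x → G (x , m))
wordSum-vertical ds zero    G = refl
wordSum-vertical ds (suc m) G =
  trans (sumℕ-map-∘ (λ d → ℕ²W.wordSum (map (_, 1) ds) m (G ∘ (d ⊕_))) (_, 1) ds)
        (sumℕ-map-cong ds (λ d → wordSum-vertical ds m (G ∘ ((d , 1) ⊕_))))

stepLetters : ℕ → List (ℕ × ℕ)
stepLetters s = map (λ st → (dx st , dy st)) (allFin (suc s))

tabulate-toℕ : ∀ n (f : ℕ → A) → tabulate (f ∘ toℕ {n}) ≡ applyUpTo f n
tabulate-toℕ zero    f = refl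
tabulate-toℕ (suc n) f = cong (f 0 ∷_) (tabulate-toℕ n (f ∘ suc))

stepLetters≡ : ∀ s → stepLetters s ≡ (1 , 0) ∷ map (_, 1) (applyUpTo suc s)
stepLetters≡ s = cong ((1 , 0) ∷_) (begin
  map (λ st → (dx st , dy st)) (tabulate Fin.suc)  ≡⟨ map-tabulate Fin.suc (λ st → (dx {s} st , dy st)) ⟩
  tabulate (λ i → (suc (toℕ i) , 1))               ≡⟨ tabulate-toℕ s (λ x → (suc x , 1)) ⟩
  applyUpTo (λ x → (suc x , 1)) s                  ≡⟨ map-applyUpTo suc (_, 1) s ⟨
  map (_, 1) (applyUpTo suc s)                     ∎)
  where open ≡-Reasoning

endpoint-∷ : ∀ {s} (st : Step s) p → endpoint (st ∷ p) ≡ (dx st , dy st) ⊕ endpoint p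
endpoint-∷ st p with endpoint p
... | x , y = refl

sumℕ-seqsOfLength : ∀ s L (G : ℕ × ℕ → ℕ) →
  sumℕ (map (G ∘ endpoint) (seqsOfLength s L)) ≡ ℕ²W.wordSum (stepLetters s) L G
sumℕ-seqsOfLength s zero    G = +-identityʳ _
sumℕ-seqsOfLength s (suc L) G = begin
  sumℕ (map (G ∘ endpoint) (seqsOfLength s (suc L)))
    ≡⟨ sumℕ-map-concatMap-map (G ∘ endpoint) _∷_ (seqsOfLength s L) (allFin (suc s)) ⟩
  sumℕ (map (λ st → sumℕ (map (λ p → G (endpoint (st ∷ p))) (seqsOfLength s L))) (allFin (suc s)))
    ≡⟨ sumℕ-map-cong (allFin (suc s)) (λ st →
         trans (sumℕ-map-cong (seqsOfLength s L) (cong G ∘ endpoint-∷ st))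
               (sumℕ-seqsOfLength s L (G ∘ ((dx st , dy st) ⊕_)))) ⟩
  sumℕ (map (λ st → ℕ²W.wordSum (stepLetters s) L (G ∘ ((dx st , dy st) ⊕_))) (allFin (suc s)))
    ≡⟨ sumℕ-map-∘ (λ d → ℕ²W.wordSum (stepLetters s) L (G ∘ (d ⊕_)))
                  (λ st → (dx st , dy st)) (allFin (suc s)) ⟨
  ℕ²W.wordSum (stepLetters s) (suc L) G ∎
  where open ≡-Reasoning

sumUpTo-C-select : ∀ L k (G : ℕ → ℕ → ℕ) → (∀ m j → m ≢ k → G m j ≡ 0) →
  (∑[ j < suc L ] (L C j) * G (L ∸ j) j) ≡ (L C k) * G k (L ∸ k)
sumUpTo-C-select L k G G≡0 with k ≤? L
... | yes k≤L = begin
  (∑[ j < suc L ] (L C j) * G (L ∸ j) j)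
    ≡⟨ sumUpTo-single (suc L) _ (L ∸ k) (s≤s (m∸n≤m L k)) (λ j j<1+L j≢L∸k →
         trans (cong ((L C j) *_) (G≡0 (L ∸ j) j (j≢L∸k ∘ L∸j≡k⇒j≡L∸k (≤-pred j<1+L))))
               (*-zeroʳ (L C j))) ⟩
  (L C (L ∸ k)) * G (L ∸ (L ∸ k)) (L ∸ k)
    ≡⟨ cong₂ _*_ (sym (nCk≡nC[n∸k] k≤L)) (cong (λ m → G m (L ∸ k)) (m∸[m∸n]≡n k≤L)) ⟩
  (L C k) * G k (L ∸ k) ∎
  where
  open ≡-Reasoning
  L∸j≡k⇒j≡L∸k : ∀ {j} → j ≤ L → L ∸ j ≡ k → j ≡ L ∸ k
  L∸j≡k⇒j≡L∸k j≤L L∸j≡k = trans (sym (m∸[m∸n]≡n j≤L)) (cong (L ∸_) L∸j≡k)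
... | no k≰L = trans
  (sumUpTo-zero (suc L) (λ j _ →
     trans (cong ((L C j) *_) (G≡0 (L ∸ j) j (λ L∸j≡k → k≰L (subst (_≤ L) L∸j≡k (m∸n≤m L j)))))
           (*-zeroʳ (L C j))))
  (sym (cong (_* G k (L ∸ k)) (k>n⇒nCk≡0 (≰⇒> k≰L))))

isPoint : ℕ × ℕ → ℕ × ℕ → ℕ
isPoint e e′ = indicator (≡-dec _≟_ _≟_ e e′)

isPoint-≡ : ∀ {e e′} → e ≡ e′ → isPoint e e′ ≡ 1
isPoint-≡ {e} {e′} = indicator-yes (≡-dec _≟_ _≟_ e e′)

isPoint-≢ : ∀ {e e′} → e ≢ e′ → isPoint e e′ ≡ 0
isPoint-≢ {e} {e′} = indicator-no (≡-dec _≟_ _≟_ e e′)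

sumℕ-pathsOfLength : ∀ s n k L →
  sumℕ (map (λ p → isPoint (endpoint p) (n , k)) (seqsOfLength s L))
    ≡ (L C k) * ℕW.wordSum (upTo s) k (λ t → isPoint (L + t , k) (n , k))
sumℕ-pathsOfLength s n k L = begin
  sumℕ (map (δ ∘ endpoint) (seqsOfLength s L))
    ≡⟨ sumℕ-seqsOfLength s L δ ⟩
  ℕ²W.wordSum (stepLetters s) L δ
    ≡⟨ cong (λ vs → ℕ²W.wordSum vs L δ) (stepLetters≡ s) ⟩
  ℕ²W.wordSum ((1 , 0) ∷ map (_, 1) ups) L δ
    ≡⟨ ℕ²W.wordSum-∷ (1 , 0) (map (_, 1) ups) L δ ⟩
  (∑[ j < suc L ] (L C j) * ℕ²W.wordSum (map (_, 1) ups) (L ∸ j) (λ t → δ ((j ℕ²W.· (1 , 0)) ⊕ t)))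
    ≡⟨ sumUpTo-cong (suc L) (λ j _ → cong ((L C j) *_) (trans
         (ℕ²W.wordSum-cong _ (L ∸ j) (λ t → cong (λ e → δ (e ⊕ t)) (·-horizontal j)))
         (wordSum-vertical ups (L ∸ j) (δ ∘ ((j , 0) ⊕_))))) ⟩
  (∑[ j < suc L ] (L C j) * G (L ∸ j) j)
    ≡⟨ sumUpTo-C-select L k G (λ m j m≢k →
         ℕW.wordSum-zero ups m (λ x → isPoint-≢ (m≢k ∘ cong proj₂))) ⟩
  (L C k) * G k (L ∸ k)
    ≡⟨ nCk*-cong L k unshift ⟩
  (L C k) * ℕW.wordSum (upTo s) k (λ t → δ (L + t , k)) ∎
  where
  open ≡-Reasoning
  δ : ℕ × ℕ → ℕ
  δ e = isPoint e (n , k)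
  ups = applyUpTo suc s
  G : ℕ → ℕ → ℕ
  G m j = ℕW.wordSum ups m (λ x → δ (j + x , m))
  unshift : k ≤ L → G k (L ∸ k) ≡ ℕW.wordSum (upTo s) k (λ t → δ (L + t , k))
  unshift k≤L = begin
    ℕW.wordSum ups k (λ x → δ (L ∸ k + x , k))
      ≡⟨ cong (λ vs → ℕW.wordSum vs k (λ x → δ (L ∸ k + x , k))) (map-upTo suc s) ⟨
    ℕW.wordSum (map suc (upTo s)) k (λ x → δ (L ∸ k + x , k))
      ≡⟨ ℕW.wordSum-translate 1 (upTo s) k (λ x → δ (L ∸ k + x , k)) ⟨
    ℕW.wordSum (upTo s) k (λ t → δ (L ∸ k + (k ℕW.· 1 + t) , k))
      ≡⟨ ℕW.wordSum-cong (upTo s) k (λ t → cong (λ x → δ (x , k)) (begin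
           L ∸ k + (k ℕW.· 1 + t) ≡⟨ cong (λ x → L ∸ k + (x + t)) (·-ℕ k) ⟩
           L ∸ k + (k + t)       ≡⟨ +-assoc (L ∸ k) k t ⟨
           L ∸ k + k + t         ≡⟨ cong (_+ t) (m∸n+n≡m k≤L) ⟩
           L + t                 ∎)) ⟩
    ℕW.wordSum (upTo s) k (λ t → δ (L + t , k)) ∎

binomℤ-+m-+n : ∀ {m n} k → m < n → binomℤ (+ m - + n) k ≡ 0
binomℤ-+m-+n {m} {n} k m<n =
  trans (cong (λ z → binomℤ z k) (trans (ℤₚ.m-n≡m⊖n m n) (ℤₚ.⊖-< m<n)))
        (negative (n ∸ m) (m<n⇒0<n∸m m<n))
  where
  negative : ∀ x → 0 < x → binomℤ (ℤ.- + x) k ≡ 0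
  negative (suc x) _ = refl

sumUpTo-C-isPoint : ∀ n k t →
  (∑[ L < suc n ] (L C k) * isPoint (L + t , k) (n , k)) ≡ binomℤ (+ n - + t) (+ k)
sumUpTo-C-isPoint n k t with t ≤? n
... | yes t≤n = begin
  (∑[ L < suc n ] (L C k) * isPoint (L + t , k) (n , k))
    ≡⟨ sumUpTo-single (suc n) (λ L → (L C k) * isPoint (L + t , k) (n , k)) (n ∸ t) (s≤s (m∸n≤m n t))
         (λ L _ L≢n∸t → trans (cong ((L C k) *_) (isPoint-≢ (L≢n∸t ∘ L+t≡n⇒L≡n∸t ∘ cong proj₁)))
                              (*-zeroʳ (L C k))) ⟩
  ((n ∸ t) C k) * isPoint (n ∸ t + t , k) (n , k)
    ≡⟨ cong (((n ∸ t) C k) *_) (isPoint-≡ (cong (_, k) (m∸n+n≡m t≤n))) ⟩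
  ((n ∸ t) C k) * 1
    ≡⟨ *-identityʳ _ ⟩
  binomℤ (+ (n ∸ t)) (+ k)
    ≡⟨ cong (λ z → binomℤ z (+ k)) (+m-+n≡+[m∸n] t≤n) ⟨
  binomℤ (+ n - + t) (+ k) ∎
  where
  open ≡-Reasoning
  L+t≡n⇒L≡n∸t : ∀ {L} → L + t ≡ n → L ≡ n ∸ t
  L+t≡n⇒L≡n∸t {L} L+t≡n = trans (sym (m+n∸n≡m L t)) (cong (_∸ t) L+t≡n)
... | no t≰n = trans
  (sumUpTo-zero (suc n) {λ L → (L C k) * isPoint (L + t , k) (n , k)} (λ L _ →
     trans (cong ((L C k) *_) (isPoint-≢ (λ eq → t≰n (subst (t ≤_) (cong proj₁ eq) (m≤n+m t L)))))
           (*-zeroʳ (L C k))))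
  (sym (binomℤ-+m-+n (+ k) (≰⇒> t≰n)))

binomS-wordSum : ∀ s n k →
  binomS s n k ≡ ℤW.wordSum (map (λ x → + x) (upTo s)) k (λ z → binomℤ (+ n - z) (+ k))
binomS-wordSum s n k = begin
  binomS s n k
    ≡⟨ length-filter (λ p → ≡-dec _≟_ _≟_ (endpoint p) (n , k)) (concatMap (seqsOfLength s) (upTo (suc n)))
     ⟩
  sumℕ (map δ (concatMap (seqsOfLength s) (upTo (suc n))))
    ≡⟨ sumℕ-map-concatMap δ (seqsOfLength s) (upTo (suc n)) ⟩
  sumℕ (map (λ L → sumℕ (map δ (seqsOfLength s L))) (upTo (suc n)))
    ≡⟨ sumℕ-map-upTo _ (suc n) ⟩
  (∑[ L < suc n ] sumℕ (map δ (seqsOfLength s L)))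
    ≡⟨ sumUpTo-cong (suc n) (λ L _ →
         trans (sumℕ-pathsOfLength s n k L) (sym (ℕW.wordSum-*ˡ (upTo s) k (L C k) _))) ⟩
  (∑[ L < suc n ] ℕW.wordSum (upTo s) k (F L))
    ≡⟨ ℕW.wordSum-sumUpTo (upTo s) k (suc n) F ⟨
  ℕW.wordSum (upTo s) k (λ t → ∑[ L < suc n ] F L t)
    ≡⟨ ℕW.wordSum-cong (upTo s) k (sumUpTo-C-isPoint n k) ⟩
  ℕW.wordSum (upTo s) k (λ t → binomℤ (+ n - + t) (+ k))
    ≡⟨ wordSum-map-hom ℤₚ.+-0-isCommutativeMonoid +-0-isCommutativeMonoid
         (λ x → + x) refl ℤₚ.pos-+ (upTo s) k (λ z → binomℤ (+ n - z) (+ k)) ⟩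
  ℤW.wordSum (map (λ x → + x) (upTo s)) k (λ z → binomℤ (+ n - z) (+ k)) ∎
  where
  open ≡-Reasoning
  δ : List (Step s) → ℕ
  δ p = isPoint (endpoint p) (n , k)
  F : ℕ → ℕ → ℕ
  F L t = (L C k) * isPoint (L + t , k) (n , k)

mainTheorem4 : (s : ℕ) → 1 ≤ s → (n k : ℕ) →
    𝒟 s k (+ n - + k) ≡ binomS s n k
mainTheorem4 (suc s′) _ n k = trans (𝒟-wordSum s′ n k) (sym (binomS-wordSum (suc s′) n k))
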